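{- In $ALFA_I$, for all graphs $A,B,C$: if $B\vdash_{ALFA_I}C$ then $AB\vdash_{ALFA_I}AC$.
   Context: Graphs of $ALFA_I$: the empty graph $\emptyset$ and propositional letters are graphs; if $G,H$ are graphs then so are the juxtaposition $GH$, the cut $[G]$ ($G$ inside a solid closed curve), the implication graph $\langle G\Rightarrow H\rangle$ (a solid closed curve containing $G$ and a dotted closed curve containing $H$), and the disjunction graph $\langle G\vee H\rangle$ (a solid closed curve containing two semi-dotted closed curves, one containing $G$ and one containing $H$; $\langle G\vee H\rangle=\langle H\vee G\rangle$). Juxtaposition is associative and commutative with unit $\emptyset$; $[\,]$ is the empty cut. Rules are schemata with $A,B,C$ arbitrary (possibly empty) graphs, applied to the whole graph on the sheet. First-degree rules: $I_\vee: A\vdash\langle A\vee B\rangle$; $I_\neg: [A]\vdash\langle A\Rightarrow[\,]\rangle$; $R_2: AB\vdash A$; $E_\neg:\langle A\Rightarrow[\,]\rangle\vdash[A]$; $MP_i: A\langle A\Rightarrow B\rangle\vdash B$; $E_\bot: [\,]\vdash A$. Second-degree rules: $R_{8i}$: if $AB\vdash C$ then $A\vdash\langle B\Rightarrow C\rangle$; $R_0$: if $A\vdash B$ and $A\vdash C$ then $A\vdash BC$; $E_\vee$: if $A\vdash C$ and $B\vdash C$ then $\langle A\vee B\rangle\vdash C$. $\vdash_{ALFA_I}$ is the least transitive relation on graphs containing all instances of the first-degree rules and closed under the second-degree rules. -}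

module Defs where

open import Data.Nat using (ℕ)

data Graph : Set where
  ∅     : Graph
  letter : ℕ → Graph
  _·_   : Graph → Graph → Graph     -- juxtaposition GH
  cut   : Graph → Graph
  ⟨_⇒_⟩ : Graph → Graph → Graph
  ⟨_∨_⟩ : Graph → Graph → Graph

infixl 6 _·_

[] : Graph
[] = cut ∅

data _≈_ : Graph → Graph → Set where
  ≈-refl  : ∀ {G} → G ≈ G
  ≈-sym   : ∀ {G H} → G ≈ H → H ≈ G
  ≈-trans : ∀ {G H K} → G ≈ H → H ≈ K → G ≈ K
  ·-assoc : ∀ {G H K} → (G · H) · K ≈ G · (H · K)
  ·-comm  : ∀ {G H} → G · H ≈ H · G
  ·-unitˡ : ∀ {G} → ∅ · G ≈ G
  ∨-comm  : ∀ {G H} → ⟨ G ∨ H ⟩ ≈ ⟨ H ∨ G ⟩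
  ·-cong  : ∀ {G G' H H'} → G ≈ G' → H ≈ H' → G · H ≈ G' · H'
  cut-cong : ∀ {G G'} → G ≈ G' → cut G ≈ cut G'
  ⇒-cong  : ∀ {G G' H H'} → G ≈ G' → H ≈ H' → ⟨ G ⇒ H ⟩ ≈ ⟨ G' ⇒ H' ⟩
  ∨-cong  : ∀ {G G' H H'} → G ≈ G' → H ≈ H' → ⟨ G ∨ H ⟩ ≈ ⟨ G' ∨ H' ⟩

infix 4 _≈_ _⊢_

-- ⊢_{ALFA_I}: least transitive relation containing the first-degree rule
-- instances and closed under the second-degree rules; graphs are taken up
-- to the identification ≈ (rule `conv`).
data _⊢_ : Graph → Graph → Set where
  conv  : ∀ {G H} → G ≈ H → G ⊢ H
  trans : ∀ {G H K} → G ⊢ H → H ⊢ K → G ⊢ K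
  I∨    : ∀ {A B} → A ⊢ ⟨ A ∨ B ⟩
  I¬    : ∀ {A} → cut A ⊢ ⟨ A ⇒ [] ⟩
  R2    : ∀ {A B} → A · B ⊢ A
  E¬    : ∀ {A} → ⟨ A ⇒ [] ⟩ ⊢ cut A
  MPi   : ∀ {A B} → A · ⟨ A ⇒ B ⟩ ⊢ B
  E⊥    : ∀ {A} → [] ⊢ A
  R8i   : ∀ {A B C} → A · B ⊢ C → A ⊢ ⟨ B ⇒ C ⟩
  R0    : ∀ {A B C} → A ⊢ B → A ⊢ C → A ⊢ B · C
  E∨    : ∀ {A B C} → A ⊢ C → B ⊢ C → ⟨ A ∨ B ⟩ ⊢ C

module Submission where

open import Defs

⊢-projectˡ : ∀ {A B} → A · B ⊢ A
⊢-projectˡ = R2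

⊢-projectʳ : ∀ {A B} → A · B ⊢ B
⊢-projectʳ = trans (conv ·-comm) R2

mainTheorem8 : (A B C : Graph) → B ⊢ C → A · B ⊢ A · C
mainTheorem8 A B C B⊢C = R0 ⊢-projectˡ (trans ⊢-projectʳ B⊢C)
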